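{- For every $n\in\mathbb N$ and every $M\in\mathbb N$, the set $$\mathcal A_{n,M}=\left\{a\in\mathbb Z:\ \gcd(a,M)=1,\ \mathrm{ord}\!\left(\tfrac{a}{M}\right)=n\right\}$$ is a disjoint union of congruence classes modulo $M^{n+1}$.
   Context: Let $\chi:\mathbb Q\to\mathbb Q$ be defined by $\chi(x)=x\lceil x\rceil$, where $\lceil x\rceil$ is the smallest integer greater than or equal to $x$. For $x\in\mathbb Q$, the order of $x$ is $\mathrm{ord}(x)=\min\{k\in\mathbb N_0:\chi^k(x)\in\mathbb Z\}$ if this set is nonempty, and $\mathrm{ord}(x)=\infty$ otherwise. Here $\mathbb N=\{1,2,\dots\}$ and $\mathbb N_0=\mathbb N\cup\{0\}$. -}

module Defs where

open import Data.Nat as ℕ using (ℕ; zero; suc; _<_; NonZero)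
open import Data.Integer as ℤ using (ℤ; +_)
open import Data.Integer.GCD using (gcd)
open import Data.Integer.Divisibility using (_∣_)
open import Data.Rational as ℚ using (ℚ; _*_; _/_; ceiling)
open import Data.Product using (Σ; _×_)
open import Relation.Nullary using (¬_)
open import Relation.Binary.PropositionalEquality using (_≡_)

χ : ℚ → ℚ
χ x = x * (ceiling x / 1)

χ^ : ℕ → ℚ → ℚ
χ^ zero    x = x
χ^ (suc k) x = χ (χ^ k x)

IsInt : ℚ → Set
IsInt x = Σ ℤ (λ z → x ≡ z / 1)

HasOrd : ℚ → ℕ → Set
HasOrd x n = IsInt (χ^ n x) × (∀ k → k < n → ¬ IsInt (χ^ k x))

InA : (n M : ℕ) → .{{_ : NonZero M}} → ℤ → Set
InA n M a = (gcd a (+ M) ≡ + 1) × HasOrd (a / M) n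

module Submission where

-- Call rationals x, y congruent modulo an integer d if x − y ∈ dℤ; integrality
-- is invariant under any such congruence.  The heart of the proof is one step
-- of χ(x) = x⌈x⌉: since ⌈y + Z⌉ = ⌈y⌉ + Z for an integer Z, one has
-- χ(y + Z) = χ(y) + Z(y + ⌈y⌉ + Z), so if M·y ∈ ℤ and x ≡ y (mod M·P), then
-- χ(x) ≡ χ(y) (mod P).  Since M·y ∈ ℤ implies M·χ(y) ∈ ℤ, iterating shows that
-- x ≡ y (mod Mⁿ) gives χᵏ(x) ≡ χᵏ(y) (mod Mⁿ⁻ᵏ) for all k ≤ n, so x and y have
-- the same order n.  Finally a ≡ b (mod Mⁿ⁺¹) gives a/M ≡ b/M (mod Mⁿ), and the
-- coprimality condition only depends on a modulo M.

open import Data.Nat as ℕ using (ℕ; zero; suc; NonZero; _^_; _∸_)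
import Data.Nat.Properties as ℕP
import Data.Nat.Divisibility as ℕ∣
open import Data.Integer as ℤ using (ℤ; +_; 1ℤ; _-_)
import Data.Integer.Properties as ℤP
import Data.Integer.DivMod as ℤD
open import Data.Integer.Divisibility using (_∣_)
import Data.Integer.Divisibility.Signed as ℤ∣
open import Data.Integer.GCD using (gcd; gcd[i,j]∣i; gcd[i,j]∣j; gcd-greatest)
import Data.Integer.Solver as ℤSolver
open import Data.Rational as ℚ using (ℚ; mkℚ; toℚᵘ; _/_; floor; ceiling; _+_; _*_; -_; _≤_; _<_)
open import Data.Rational.Properties
  using (toℚᵘ-injective; toℚᵘ-fromℚᵘ; toℚᵘ-homo-+; toℚᵘ-homo-*; toℚᵘ-homo‿-;
         toℚᵘ-cancel-≤; toℚᵘ-cancel-<; toℚᵘ-mono-<; ≤-<-trans; +-monoˡ-≤; +-monoˡ-<; neg-distrib-+)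
import Data.Rational.Unnormalised as U
import Data.Rational.Unnormalised.Properties as UP
import Data.Rational.Solver as ℚSolver
open import Data.Product using (_,_)
open import Function.Bundles using (_⇔_; mk⇔)
open import Relation.Binary.PropositionalEquality

open import Defs

ι : ℤ → ℚ
ι z = z / 1

toℚᵘ-ι : ∀ z → toℚᵘ (ι z) U.≃ U.mkℚᵘ z 0
toℚᵘ-ι z = toℚᵘ-fromℚᵘ (U.mkℚᵘ z 0)

-- A rational whose unnormalised image is z/1 is ι z; this reduces
-- identities about ι to cross-multiplication identities in ℤ.
≃-ι : ∀ {q} z → toℚᵘ q U.≃ U.mkℚᵘ z 0 → q ≡ ι z
≃-ι z h = toℚᵘ-injective (UP.≃-trans h (UP.≃-sym (toℚᵘ-ι z)))

ι-+ : ∀ a b → ι (a ℤ.+ b) ≡ ι a + ι b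
ι-+ a b = sym (≃-ι (a ℤ.+ b) (UP.≃-trans (toℚᵘ-homo-+ (ι a) (ι b))
  (UP.≃-trans (UP.+-cong (toℚᵘ-ι a) (toℚᵘ-ι b))
    (U.*≡* (solve 2 (λ a b → (a :* con 1ℤ :+ b :* con 1ℤ) :* con 1ℤ := (a :+ b) :* con 1ℤ) refl a b)))))
  where open ℤSolver.+-*-Solver

ι-* : ∀ a b → ι (a ℤ.* b) ≡ ι a * ι b
ι-* a b = sym (≃-ι (a ℤ.* b) (UP.≃-trans (toℚᵘ-homo-* (ι a) (ι b))
  (UP.≃-trans (UP.*-cong (toℚᵘ-ι a) (toℚᵘ-ι b)) (U.*≡* refl))))

ι-neg : ∀ a → ι (ℤ.- a) ≡ - ι a
ι-neg a = sym (≃-ι (ℤ.- a) (UP.≃-trans (toℚᵘ-homo‿- (ι a)) (UP.-‿cong (toℚᵘ-ι a))))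

ι≤ : ∀ m p → m ℤ.* ℚ.↧ p ℤ.≤ ℚ.↥ p → ι m ≤ p
ι≤ m p@(mkℚ n d _) h =
  toℚᵘ-cancel-≤ (UP.≤-respˡ-≃ (UP.≃-sym (toℚᵘ-ι m)) (U.*≤* (subst (m ℤ.* + suc d ℤ.≤_) (sym (ℤP.*-identityʳ n)) h)))

<ι : ∀ m p → ℚ.↥ p ℤ.< m ℤ.* ℚ.↧ p → p < ι m
<ι m p@(mkℚ n d _) h =
  toℚᵘ-cancel-< (UP.<-respʳ-≃ (UP.≃-sym (toℚᵘ-ι m)) (U.*<* (subst (ℤ._< m ℤ.* + suc d) (sym (ℤP.*-identityʳ n)) h)))

ι-cancel-< : ∀ a b → ι a < ι b → a ℤ.< b
ι-cancel-< a b h with UP.<-respʳ-≃ (toℚᵘ-ι b) (UP.<-respˡ-≃ (toℚᵘ-ι a) (toℚᵘ-mono-< h))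
... | U.*<* a<b = subst₂ ℤ._<_ (ℤP.*-identityʳ a) (ℤP.*-identityʳ b) a<b

floor-lower : ∀ p → ι (floor p) ≤ p
floor-lower p@(mkℚ n d _) = ι≤ (floor p) p (ℤD.[n/d]*d≤n n (+ suc d))

floor-upper : ∀ p → p < ι (ℤ.suc (floor p))
floor-upper p@(mkℚ n d _) = <ι (ℤ.suc (floor p)) p
  (subst (λ q → n ℤ.< ℤ.suc q ℤ.* + suc d) (sym (ℤD.div-pos-is-/ℕ n (suc d))) (ℤD.n<s[n/ℕd]*d n (suc d)))

floor-unique : ∀ m p → ι m ≤ p → p < ι (ℤ.suc m) → floor p ≡ m
floor-unique m p m≤p p<m+1 = ℤP.≤-antisym (below (≤-<-trans (floor-lower p) p<m+1)) (below (≤-<-trans m≤p (floor-upper p)))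
  where
  below : ∀ {i j} → ι i < ι (ℤ.suc j) → i ℤ.≤ j
  below {i} {j} h = subst (i ℤ.≤_) (ℤP.pred-suc j) (ℤP.i<j⇒i≤pred[j] (ι-cancel-< i (ℤ.suc j) h))

floor-shift : ∀ p z → floor (p + ι z) ≡ floor p ℤ.+ z
floor-shift p z = floor-unique (floor p ℤ.+ z) (p + ι z)
  (subst (_≤ p + ι z) (sym (ι-+ (floor p) z)) (+-monoˡ-≤ (ι z) (floor-lower p)))
  (subst (p + ι z <_) (trans (sym (ι-+ (ℤ.suc (floor p)) z)) (cong ι (ℤP.+-assoc 1ℤ (floor p) z)))
    (+-monoˡ-< (ι z) (floor-upper p)))

-- The library defines ⌈p⌉ as -⌊-p⌋ (by matching on the record).
ceiling≡-floor- : ∀ p → ceiling p ≡ ℤ.- floor (- p)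
ceiling≡-floor- (mkℚ _ _ _) = refl

-- Via ⌈p⌉ = −⌊−p⌋, translation invariance passes from floor to ceiling.
ceiling-shift : ∀ p z → ceiling (p + ι z) ≡ ceiling p ℤ.+ z
ceiling-shift p z = begin
  ceiling (p + ι z)               ≡⟨ ceiling≡-floor- (p + ι z) ⟩
  ℤ.- floor (- (p + ι z))         ≡⟨ cong (λ q → ℤ.- floor q) (trans (neg-distrib-+ p (ι z)) (cong (_+_ (- p)) (sym (ι-neg z)))) ⟩
  ℤ.- floor (- p + ι (ℤ.- z))     ≡⟨ cong ℤ.-_ (floor-shift (- p) (ℤ.- z)) ⟩
  ℤ.- (floor (- p) ℤ.+ ℤ.- z)     ≡⟨ ℤP.neg-distrib-+ (floor (- p)) (ℤ.- z) ⟩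
  ℤ.- floor (- p) ℤ.+ ℤ.- ℤ.- z   ≡⟨ cong₂ ℤ._+_ (sym (ceiling≡-floor- p)) (ℤP.neg-involutive z) ⟩
  ceiling p ℤ.+ z                 ∎
  where open ≡-Reasoning

χ-shift : ∀ y Z → χ (y + ι Z) ≡ χ y + ι Z * (y + ι (ceiling y ℤ.+ Z))
χ-shift y Z = begin
  (y + ι Z) * ι (ceiling (y + ι Z))         ≡⟨ cong (λ c → (y + ι Z) * ι c) (ceiling-shift y Z) ⟩
  (y + ι Z) * ι (ceiling y ℤ.+ Z)           ≡⟨ cong ((y + ι Z) *_) (ι-+ (ceiling y) Z) ⟩
  (y + ι Z) * (ι (ceiling y) + ι Z)         ≡⟨ solve 3 (λ y c z → (y :+ z) :* (c :+ z) := y :* c :+ z :* (y :+ (c :+ z))) refl y (ι (ceiling y)) (ι Z) ⟩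
  χ y + ι Z * (y + (ι (ceiling y) + ι Z))   ≡⟨ cong (λ w → χ y + ι Z * (y + w)) (sym (ι-+ (ceiling y) Z)) ⟩
  χ y + ι Z * (y + ι (ceiling y ℤ.+ Z))     ∎
  where
  open ≡-Reasoning
  open ℚSolver.+-*-Solver

infix 4 _≈_mod_
record _≈_mod_ (x y : ℚ) (d : ℤ) : Set where
  constructor _,_
  field
    quotient   : ℤ
    difference : x ≡ y + ι (d ℤ.* quotient)

≈mod-sym : ∀ {x y d} → x ≈ y mod d → y ≈ x mod d
≈mod-sym {x} {y} {d} (t , x≡y+dt) = ℤ.- t , (begin
  y                                 ≡⟨ solve 2 (λ y e → y := (y :+ e) :+ (:- e)) refl y (ι (d ℤ.* t)) ⟩
  (y + ι (d ℤ.* t)) + - ι (d ℤ.* t) ≡⟨ cong₂ _+_ (sym x≡y+dt) (sym (trans (cong ι (sym (ℤP.neg-distribʳ-* d t))) (ι-neg (d ℤ.* t)))) ⟩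
  x + ι (d ℤ.* ℤ.- t)               ∎)
  where
  open ≡-Reasoning
  open ℚSolver.+-*-Solver

≈mod-integral : ∀ {x y d} → x ≈ y mod d → IsInt y → IsInt x
≈mod-integral {d = d} (t , x≡y+dt) (z , y≡z) =
  z ℤ.+ d ℤ.* t , trans x≡y+dt (trans (cong (_+ ι (d ℤ.* t)) y≡z) (sym (ι-+ z (d ℤ.* t))))

≈mod-resp : ∀ {x y d e} → d ≡ e → x ≈ y mod d → x ≈ y mod e
≈mod-resp refl x≡y = x≡y

χ-m-integral : ∀ m y → IsInt (ι m * y) → IsInt (ι m * χ y)
χ-m-integral m y (w , my≡w) = w ℤ.* ceiling y , (begin
  ι m * (y * ι (ceiling y))   ≡⟨ solve 3 (λ m y c → m :* (y :* c) := (m :* y) :* c) refl (ι m) y (ι (ceiling y)) ⟩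
  (ι m * y) * ι (ceiling y)   ≡⟨ cong (_* ι (ceiling y)) my≡w ⟩
  ι w * ι (ceiling y)         ≡⟨ sym (ι-* w (ceiling y)) ⟩
  ι (w ℤ.* ceiling y)         ∎)
  where
  open ≡-Reasoning
  open ℚSolver.+-*-Solver

χ^-m-integral : ∀ m j y → IsInt (ι m * y) → IsInt (ι m * χ^ j y)
χ^-m-integral m zero    y my = my
χ^-m-integral m (suc j) y my = χ-m-integral m (χ^ j y) (χ^-m-integral m j y my)

-- The key step: if m·y ∈ ℤ, then χ maps congruence modulo mP to congruence modulo P.
-- With x = y + Z, Z = mPt, we get χ(x) − χ(y) = Z(y + ⌈x⌉) = P·t·(my + m⌈x⌉).
χ-step : ∀ m P {x y} → IsInt (ι m * y) → x ≈ y mod m ℤ.* P → χ x ≈ χ y mod P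
χ-step m P {y = y} (w , my≡w) (t , refl) = t ℤ.* (w ℤ.+ m ℤ.* c) , (begin
  χ (y + ι Z)                                  ≡⟨ χ-shift y Z ⟩
  χ y + ι Z * (y + ι c)                        ≡⟨ cong (λ v → χ y + v * (y + ι c)) (trans (ι-* (m ℤ.* P) t) (cong (_* ι t) (ι-* m P))) ⟩
  χ y + (ι m * ι P) * ι t * (y + ι c)          ≡⟨ cong (_+_ (χ y)) (solve 5 (λ m p t y c → (m :* p) :* t :* (y :+ c) := p :* (t :* (m :* y :+ m :* c))) refl (ι m) (ι P) (ι t) y (ι c)) ⟩
  χ y + ι P * (ι t * (ι m * y + ι m * ι c))    ≡⟨ cong₂ (λ u v → χ y + ι P * (ι t * (u + v))) my≡w (sym (ι-* m c)) ⟩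
  χ y + ι P * (ι t * (ι w + ι (m ℤ.* c)))      ≡⟨ cong (λ v → χ y + ι P * (ι t * v)) (sym (ι-+ w (m ℤ.* c))) ⟩
  χ y + ι P * (ι t * ι (w ℤ.+ m ℤ.* c))        ≡⟨ cong (λ v → χ y + ι P * v) (sym (ι-* t (w ℤ.+ m ℤ.* c))) ⟩
  χ y + ι P * ι (t ℤ.* (w ℤ.+ m ℤ.* c))        ≡⟨ cong (_+_ (χ y)) (sym (ι-* P (t ℤ.* (w ℤ.+ m ℤ.* c)))) ⟩
  χ y + ι (P ℤ.* (t ℤ.* (w ℤ.+ m ℤ.* c)))      ∎)
  where
  Z = (m ℤ.* P) ℤ.* t
  c = ceiling y ℤ.+ Z
  open ≡-Reasoning
  open ℚSolver.+-*-Solver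

χ^-congruence : ∀ M j k {x y} → IsInt (ι (+ M) * y) →
  x ≈ y mod + (M ^ (j ℕ.+ k)) → χ^ j x ≈ χ^ j y mod + (M ^ k)
χ^-congruence M zero    k My x≈y = x≈y
χ^-congruence M (suc j) k {y = y} My x≈y =
  χ-step (+ M) (+ (M ^ k)) (χ^-m-integral (+ M) j y My)
    (≈mod-resp (ℤP.pos-* M (M ^ k))
      (χ^-congruence M j (suc k) My (≈mod-resp (cong (λ i → + (M ^ i)) (sym (ℕP.+-suc j k))) x≈y)))

/-shift : ∀ b z K .{{_ : NonZero K}} → (b ℤ.+ + K ℤ.* z) / K ≡ b / K + ι z
/-shift b z K@(suc k) = toℚᵘ-injective (begin
  toℚᵘ ((b ℤ.+ + K ℤ.* z) / K)         ≈⟨ toℚᵘ-fromℚᵘ (U.mkℚᵘ (b ℤ.+ + K ℤ.* z) k) ⟩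
  U.mkℚᵘ (b ℤ.+ + K ℤ.* z) k           ≈⟨ U.*≡* (solve 3 (λ b z K → (b :+ K :* z) :* (K :* con 1ℤ) := (b :* con 1ℤ :+ z :* K) :* K) refl b z (+ K)) ⟩
  U.mkℚᵘ b k U.+ U.mkℚᵘ z 0            ≈⟨ UP.+-cong (toℚᵘ-fromℚᵘ (U.mkℚᵘ b k)) (toℚᵘ-ι z) ⟨
  toℚᵘ (b / K) U.+ toℚᵘ (ι z)          ≈⟨ toℚᵘ-homo-+ (b / K) (ι z) ⟨
  toℚᵘ (b / K + ι z)                   ∎)
  where
  open UP.≃-Reasoning
  open ℤSolver.+-*-Solver

ι*/-cancel : ∀ b K .{{_ : NonZero K}} → ι (+ K) * (b / K) ≡ ι b
ι*/-cancel b K@(suc k) = ≃-ι b (UP.≃-trans (toℚᵘ-homo-* (ι (+ K)) (b / K))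
  (UP.≃-trans (UP.*-cong (toℚᵘ-ι (+ K)) (toℚᵘ-fromℚᵘ (U.mkℚᵘ b k)))
    (U.*≡* (solve 2 (λ b K → (K :* b) :* con 1ℤ := b :* (con 1ℤ :* K)) refl b (+ K)))))
  where open ℤSolver.+-*-Solver

/-congruence : ∀ K D a b .{{_ : NonZero K}} → (+ K ℤ.* D) ℤ∣.∣ (a - b) → a / K ≈ b / K mod D
/-congruence K D a b (ℤ∣.divides q a-b≡q[KD]) = q , (begin
  a / K                         ≡⟨ cong (λ n → n / K) a≡b+K[Dq] ⟩
  (b ℤ.+ + K ℤ.* (D ℤ.* q)) / K ≡⟨ /-shift b (D ℤ.* q) K ⟩
  b / K + ι (D ℤ.* q)           ∎)
  where
  open ≡-Reasoning
  open ℤSolver.+-*-Solver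
  a≡b+K[Dq] : a ≡ b ℤ.+ + K ℤ.* (D ℤ.* q)
  a≡b+K[Dq] = begin
    a                         ≡⟨ solve 2 (λ a b → a := b :+ (a :- b)) refl a b ⟩
    b ℤ.+ (a - b)             ≡⟨ cong (ℤ._+_ b) a-b≡q[KD] ⟩
    b ℤ.+ q ℤ.* (+ K ℤ.* D)   ≡⟨ cong (ℤ._+_ b) (solve 3 (λ q K D → q :* (K :* D) := K :* (D :* q)) refl q (+ K) D) ⟩
    b ℤ.+ + K ℤ.* (D ℤ.* q)   ∎

-- gcd(·, d) = 1 is a property of residue classes modulo d: gcd(b,d) divides b and d, hence a.
coprime-congruent : ∀ {a b d} → d ℤ∣.∣ (a - b) → gcd a d ≡ + 1 → gcd b d ≡ + 1
coprime-congruent {a} {b} {d} d∣a-b gcd[a,d]≡1 =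
  cong +_ (ℕ∣.∣1⇒≡1 (subst (gcd b d ∣_) gcd[a,d]≡1 (gcd-greatest {a} {d} {gcd b d} (ℤ∣.∣⇒∣ᵤ g∣a) (gcd[i,j]∣j b d))))
  where
  open ℤSolver.+-*-Solver
  g∣a : gcd b d ℤ∣.∣ a
  g∣a = subst (gcd b d ℤ∣.∣_) (solve 2 (λ a b → (a :- b) :+ b := a) refl a b)
    (ℤ∣.∣m∣n⇒∣m+n (ℤ∣.∣-trans (ℤ∣.∣ᵤ⇒∣ (gcd[i,j]∣j b d)) d∣a-b) (ℤ∣.∣ᵤ⇒∣ (gcd[i,j]∣i b d)))

-- If M·y ∈ ℤ and x ≡ y modulo Mⁿ, then χᵏ(x) ≡ χᵏ(y) for every k ≤ n, so x and y
-- have the same integrality pattern up to step n and hence ord(x) = n ⇒ ord(y) = n.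
ord-congruent : ∀ M n {x y} → IsInt (ι (+ M) * y) → x ≈ y mod + (M ^ n) → HasOrd x n → HasOrd y n
ord-congruent M n {x} {y} My x≈y (int-at-n , not-int-below-n) =
  ≈mod-integral (≈mod-sym (congruent-at n ℕP.≤-refl)) int-at-n ,
  λ k k<n int-at-k → not-int-below-n k k<n (≈mod-integral (congruent-at k (ℕP.<⇒≤ k<n)) int-at-k)
  where
  congruent-at : ∀ k → k ℕ.≤ n → χ^ k x ≈ χ^ k y mod + (M ^ (n ∸ k))
  congruent-at k k≤n =
    χ^-congruence M k (n ∸ k) My (≈mod-resp (cong (λ i → + (M ^ i)) (sym (ℕP.m+[n∸m]≡n k≤n))) x≈y)

InA-congruent : ∀ n M .{{_ : NonZero M}} a b → + (M ^ suc n) ∣ (a - b) → InA n M a → InA n M b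
InA-congruent n M a b Mⁿ⁺¹∣a-b (coprime , ord) =
  coprime-congruent {a} {b} M∣a-b coprime ,
  ord-congruent M n (b , ι*/-cancel b M) (/-congruence M (+ (M ^ n)) a b M·Mⁿ∣a-b) ord
  where
  M·Mⁿ∣a-b : + M ℤ.* + (M ^ n) ℤ∣.∣ (a - b)
  M·Mⁿ∣a-b = subst (ℤ∣._∣ (a - b)) (ℤP.pos-* M (M ^ n)) (ℤ∣.∣ᵤ⇒∣ Mⁿ⁺¹∣a-b)
  M∣a-b : + M ℤ∣.∣ (a - b)
  M∣a-b = ℤ∣.∣-trans (ℤ∣.∣m⇒∣m*n (+ (M ^ n)) (ℤ∣.∣-refl {+ M})) M·Mⁿ∣a-b

-- Proposition 2.2: A_{n,M} is a union of residue classes modulo Mⁿ⁺¹; both directions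
-- are InA-congruent, using that |a − b| = |b − a|.
proposition2p2 : (n M : ℕ) → .{{_ : NonZero n}} → .{{_ : NonZero M}} →
    (a b : ℤ) → (+ (M ^ suc n)) ∣ (a - b) → (InA n M a ⇔ InA n M b)
proposition2p2 n M a b Mⁿ⁺¹∣a-b =
  mk⇔ (InA-congruent n M a b Mⁿ⁺¹∣a-b) (InA-congruent n M b a Mⁿ⁺¹∣b-a)
  where
  Mⁿ⁺¹∣b-a : + (M ^ suc n) ∣ (b - a)
  Mⁿ⁺¹∣b-a = subst (M ^ suc n ℕ∣.∣_) (ℤP.∣i-j∣≡∣j-i∣ a b) Mⁿ⁺¹∣a-b
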